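{- Let $\mathcal{F}\subseteq[\omega]^{<\omega}$ and suppose there is a function $f:\omega\to\omega$ such that for every $n<\omega$ and every $A\in[\omega]^n$ there is $B\in[\omega]^{<f(n)}$ with $A\subseteq B$ and $B\in\mathcal{F}$. Then $\mathrm{VC}(\mathcal{F})=\infty$.
   Context: $[\omega]^n$ and $[\omega]^{<m}$ denote the sets of subsets of $\omega$ of size exactly $n$, respectively less than $m$. A set $A$ is shattered by $\mathcal{F}$ if for every $A_0\subseteq A$ there is $S\in\mathcal{F}$ with $A_0=A\cap S$; $\mathrm{VC}(\mathcal{F})$ is the maximal size of a finite shattered set, or $\infty$ if unbounded. -}

module Defs where

open import Data.Nat using (ℕ; _<_; _≥_)
open import Data.List using (List; length)
open import Data.List.Relation.Unary.Linked using (Linked)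
open import Data.List.Membership.Propositional using (_∈_)
open import Data.Product using (Σ; _×_; proj₁; ∃-syntax)
open import Function.Bundles using (_⇔_)

-- A finite subset of ω, represented canonically as a strictly increasing list.
FinSet : Set
FinSet = Σ (List ℕ) (Linked _<_)

_∈ₛ_ : ℕ → FinSet → Set
x ∈ₛ A = x ∈ proj₁ A

∣_∣ₛ : FinSet → ℕ
∣ A ∣ₛ = length (proj₁ A)

_⊆ₛ_ : FinSet → FinSet → Set
A ⊆ₛ B = ∀ x → x ∈ₛ A → x ∈ₛ B

Family : Set₁
Family = FinSet → Set

Shattered : Family → FinSet → Set
Shattered 𝓕 A =
  ∀ (A₀ : FinSet) → A₀ ⊆ₛ A →
    ∃[ S ] (𝓕 S × (∀ x → (x ∈ₛ A₀) ⇔ (x ∈ₛ A × x ∈ₛ S)))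

VCInfinite : Family → Set
VCInfinite 𝓕 = ∀ (m : ℕ) → ∃[ A ] (∣ A ∣ₛ ≥ m × Shattered 𝓕 A)

-- Fix m and, for every strictly increasing l with |l| ≤ m, a witness W l ∈ 𝓕 containing l; all
-- these witnesses have size at most K = f 0 + ⋯ + f m. It suffices to find an m-element set A that
-- is free for W: no x ∈ A lies in W l for any l ⊆ A ∖ {x}. Then A ∩ W A₀ = A₀ for every A₀ ⊆ A.
-- A free set is built from the top down, each new element below all earlier ones. The bounds below
-- which the remaining elements will be chosen are fixed in advance, so when x is chosen it can
-- already avoid W l for every l contained in those future elements and the earlier ones; there are
-- only boundedly many such l, each W l is small, so such an x exists by counting.
module Submission where

open import Defs
open import Data.Nat using (ℕ; _<_)
open import Data.Product using (_×_; ∃-syntax)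
open import Relation.Binary.PropositionalEquality using (_≡_)

open import Data.Nat using (zero; suc; _+_; _*_; _≤_; z≤n; s≤s; _<?_; _≤?_; _≟_)
open import Data.Nat.Properties
open import Data.Fin using (Fin; toℕ)
open import Data.Fin.Properties using (injective⇒≤; any?; toℕ≤pred[n]; toℕ-injective)
open import Data.List using (List; []; _∷_; _++_; length; map; concatMap; upTo; lookup)
open import Data.List.Properties using (length-++; length-map; length-upTo)
open import Data.List.Relation.Unary.Linked using (Linked; []; [-]; _∷_; linked?)
open import Data.List.Relation.Unary.Linked.Properties using (Linked⇒AllPairs)
open import Data.List.Relation.Unary.AllPairs as AllPairs using (_∷_)
open import Data.List.Relation.Unary.All as All using (All; []; _∷_)
open import Data.List.Relation.Unary.Any as Any using (here; there; index)
open import Data.List.Relation.Unary.Any.Properties using (lookup-index)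
open import Data.List.Relation.Unary.Unique.Propositional using (Unique)
open import Data.List.Relation.Binary.Subset.Propositional using (_⊆_)
open import Data.List.Relation.Binary.Subset.Propositional.Properties
  using (⊆-trans; ∈-∷⁺ʳ; ⊆∷∧∉⇒⊆; xs⊆xs++ys; ++⁺ʳ)
open import Data.List.Membership.Propositional using (_∈_; _∉_)
open import Data.List.Membership.Propositional.Properties
  using (∈-map⁺; ∈-++⁺ʳ; ∈-upTo⁺; ∈-upTo⁻; ∈-lookup; ∈-concatMap⁺)
open import Data.List.Membership.DecPropositional _≟_ using (_∈?_)
open import Data.Product using (_,_; proj₁; proj₂)
open import Data.Sum using (inj₁; inj₂)
open import Function using (Injective; _∘_)
open import Function.Bundles using (mk⇔)
open import Relation.Nullary using (yes; no; contradiction)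
open import Relation.Nullary.Decidable using (decidable-stable; ¬?)
open import Relation.Binary.PropositionalEquality using (refl; sym; trans; cong; subst)

module _ {a} {A : Set a} where

  ∈-index-injective : ∀ {x y : A} {xs} (p : x ∈ xs) (q : y ∈ xs) → index p ≡ index q → x ≡ y
  ∈-index-injective {xs = xs} p q eq =
    trans (lookup-index p) (trans (cong (lookup xs) eq) (sym (lookup-index q)))

  injection∈⇒≤ : ∀ {n} {xs : List A} (g : Fin n → A) → Injective _≡_ _≡_ g →
    (∀ i → g i ∈ xs) → n ≤ length xs
  injection∈⇒≤ g g-inj g∈ = injective⇒≤ λ {i} {j} eq → g-inj (∈-index-injective (g∈ i) (g∈ j) eq)

  Unique⇒lookup-injective : ∀ {xs : List A} → Unique xs → Injective _≡_ _≡_ (lookup xs)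
  Unique⇒lookup-injective {xs = _ ∷ _} (_  ∷ _) {Fin.zero}  {Fin.zero}  _  = refl
  Unique⇒lookup-injective {xs = _ ∷ _} (x≢ ∷ _) {Fin.zero}  {Fin.suc j} eq =
    contradiction eq (All.lookup x≢ (∈-lookup j))
  Unique⇒lookup-injective {xs = _ ∷ _} (x≢ ∷ _) {Fin.suc i} {Fin.zero}  eq =
    contradiction (sym eq) (All.lookup x≢ (∈-lookup i))
  Unique⇒lookup-injective {xs = _ ∷ _} (_ ∷ u) {Fin.suc i} {Fin.suc j} eq =
    cong Fin.suc (Unique⇒lookup-injective u eq)

  Unique-⊆⇒length≤ : ∀ {xs ys : List A} → Unique xs → xs ⊆ ys → length xs ≤ length ys
  Unique-⊆⇒length≤ {xs} u xs⊆ys =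
    injection∈⇒≤ (lookup xs) (Unique⇒lookup-injective u) (xs⊆ys ∘ ∈-lookup)

  length-concatMap-≤ : ∀ {b} {B : Set b} (h : A → List B) {n} xs →
    (∀ x → length (h x) ≤ n) → length (concatMap h xs) ≤ length xs * n
  length-concatMap-≤ h []       _ = z≤n
  length-concatMap-≤ h (x ∷ xs) h≤ rewrite length-++ (h x) {concatMap h xs} =
    +-mono-≤ (h≤ x) (length-concatMap-≤ h xs h≤)

  listsOver : ℕ → List A → List (List A)
  listsOver zero    C = [] ∷ []
  listsOver (suc k) C = [] ∷ concatMap (λ x → map (x ∷_) (listsOver k C)) C

  ∈-listsOver : ∀ k C {xs : List A} → xs ⊆ C → length xs ≤ k → xs ∈ listsOver k C
  ∈-listsOver zero    C {[]}     _   _         = here refl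
  ∈-listsOver (suc k) C {[]}     _   _         = here refl
  ∈-listsOver (suc k) C {x ∷ xs} x∷xs⊆C (s≤s xs≤k) =
    there (∈-concatMap⁺ _ (Any.map (λ { refl → ∈-map⁺ (x ∷_) xs∈ }) (x∷xs⊆C (here refl))))
    where
    xs∈ : xs ∈ listsOver k C
    xs∈ = ∈-listsOver k C (x∷xs⊆C ∘ there) xs≤k

listCount : ℕ → ℕ → ℕ
listCount zero    c = 1
listCount (suc k) c = suc (c * listCount k c)

length-listsOver : ∀ {a} {A : Set a} k (C : List A) → length (listsOver k C) ≤ listCount k (length C)
length-listsOver zero    C = ≤-refl
length-listsOver (suc k) C = s≤s (length-concatMap-≤ _ C λ x →
  subst (_≤ listCount k (length C)) (sym (length-map (x ∷_) (listsOver k C))) (length-listsOver k C))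

∃∉-above : ∀ b (xs : List ℕ) → ∃[ i ] (i ≤ length xs × b + i ∉ xs)
∃∉-above b xs with any? {n = suc (length xs)} (λ i → ¬? (b + toℕ i ∈? xs))
... | yes (i , b+i∉xs) = toℕ i , toℕ≤pred[n] i , b+i∉xs
... | no  none         = contradiction
  (injection∈⇒≤ (λ i → b + toℕ i) (toℕ-injective ∘ +-cancelˡ-≡ b _ _)
    (λ i → decidable-stable (b + toℕ i ∈? xs) (λ b+i∉xs → none (i , b+i∉xs))))
  (n≮n (length xs))

Linked<⇒Unique : ∀ {xs} → Linked _<_ xs → Unique xs
Linked<⇒Unique = AllPairs.map <⇒≢ ∘ Linked⇒AllPairs <-trans

∷-Linked< : ∀ {x b xs} → x < b → All (b ≤_) xs → Linked _<_ xs → Linked _<_ (x ∷ xs)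
∷-Linked< x<b []        _  = [-]
∷-Linked< x<b (b≤y ∷ _) ys = <-≤-trans x<b b≤y ∷ ys

partialSum : (ℕ → ℕ) → ℕ → ℕ
partialSum f zero    = f zero
partialSum f (suc n) = f (suc n) + partialSum f n

≤-partialSum : ∀ f {n} k → n ≤ k → f n ≤ partialSum f k
≤-partialSum f zero    z≤n = ≤-refl
≤-partialSum f (suc k) n≤1+k with m≤n⇒m<n∨m≡n n≤1+k
... | inj₂ refl       = m≤m+n _ _
... | inj₁ (s≤s n≤k)  = ≤-trans (≤-partialSum f k n≤k) (m≤n+m _ _)

module FreeSet (m K : ℕ) (W : List ℕ → List ℕ) (W-bounded : ∀ l → length (W l) ≤ K) where

  Free : List ℕ → Set
  Free A = ∀ x → x ∈ A → ∀ l → l ⊆ A → x ∉ l → length l ≤ m → x ∉ W l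

  -- U is free even against subsets using points of P, the pool from which later points are drawn.
  FreeOver : List ℕ → List ℕ → Set
  FreeOver P U = ∀ x → x ∈ U → ∀ l → l ⊆ U ++ P → x ∉ l → length l ≤ m → x ∉ W l

  forbidden : List ℕ → List ℕ
  forbidden C = concatMap W (listsOver m C)

  gap : ℕ → ℕ
  gap c = listCount m c * K

  length-forbidden : ∀ C → length (forbidden C) ≤ gap (length C)
  length-forbidden C = ≤-trans (length-concatMap-≤ W (listsOver m C) W-bounded)
                               (*-monoˡ-≤ K (length-listsOver m C))

  fresh : ∀ t U → ∃[ a ] (t ≤ a × a < t + suc (gap (length U + t)) × a ∉ forbidden (U ++ upTo t))
  fresh t U with ∃∉-above t (forbidden (U ++ upTo t))
  ... | i , i≤ , t+i∉ = t + i , m≤m+n t i , +-monoʳ-< t (s≤s (≤-trans i≤ |forbidden|≤)) , t+i∉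
    where
    |forbidden|≤ : length (forbidden (U ++ upTo t)) ≤ gap (length U + t)
    |forbidden|≤ = subst (λ c → length (forbidden (U ++ upTo t)) ≤ gap c)
      (trans (length-++ U) (cong (length U +_) (length-upTo t))) (length-forbidden (U ++ upTo t))

  extendFree : ∀ {a t t′ U} → t ≤ a → a < t′ → a ∉ forbidden (U ++ upTo t) →
    FreeOver (upTo t′) U → FreeOver (upTo t) (a ∷ U)
  extendFree {U = U} _ _ a∉ _ x (here refl) l l⊆ a∉l l≤m a∈W =
    a∉ (∈-concatMap⁺ W (Any.map (λ { refl → a∈W }) (∈-listsOver m (U ++ _) (⊆∷∧∉⇒⊆ l⊆ a∉l) l≤m)))
  extendFree {U = U} t≤a a<t′ _ free x (there x∈U) l l⊆ =
    free x x∈U l (⊆-trans l⊆ (∈-∷⁺ʳ (∈-++⁺ʳ U (∈-upTo⁺ a<t′)) (++⁺ʳ U upTo-mono)))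
    where
    upTo-mono : upTo _ ⊆ upTo _
    upTo-mono = ∈-upTo⁺ ∘ (λ y<t → <-≤-trans y<t (<⇒≤ (≤-<-trans t≤a a<t′))) ∘ ∈-upTo⁻

  -- Once u points are chosen, the remaining j are all chosen below bound j u.
  bound : ℕ → ℕ → ℕ
  bound zero    u = 0
  bound (suc j) u = bound j (suc u) + suc (gap (u + bound j (suc u)))

  build : ∀ j U → Linked _<_ U → All (bound j (length U) ≤_) U →
    FreeOver (upTo (bound j (length U))) U → ∃[ A ] (length A ≡ j + length U × Linked _<_ A × Free A)
  build zero U sorted _ free =
    U , refl , sorted , λ x x∈U l l⊆U → free x x∈U l (⊆-trans l⊆U (xs⊆xs++ys U []))
  build (suc j) U sorted above free with fresh (bound j (suc (length U))) U
  ... | a , t≤a , a<b , a∉ with build j (a ∷ U) (∷-Linked< a<b above sorted)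
         (t≤a ∷ All.map (≤-trans (m≤m+n _ _)) above) (extendFree t≤a a<b a∉ free)
  ... | A , |A| , sortedA , freeA = A , trans |A| (+-suc j (length U)) , sortedA , freeA

  freeSet : ∀ n → ∃[ A ] (length A ≡ n × Linked _<_ A × Free A)
  freeSet n with build n [] [] [] (λ _ ())
  ... | A , |A| , sorted , free = A , trans |A| (+-identityʳ n) , sorted , free

module Witnesses (𝓕 : Family) (f : ℕ → ℕ)
  (H : ∀ (n : ℕ) (A : FinSet) → ∣ A ∣ₛ ≡ n → ∃[ B ] (∣ B ∣ₛ < f n × A ⊆ₛ B × 𝓕 B))
  (m : ℕ) where

  -- Total on all lists, with the empty set as junk value outside sorted lists of length ≤ m.
  cover : ∀ l → ∃[ B ] (∣ B ∣ₛ ≤ partialSum f m ×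
                        (Linked _<_ l → length l ≤ m → l ⊆ proj₁ B × 𝓕 B))
  cover l with linked? _<?_ l | length l ≤? m
  ... | yes sorted | yes l≤m =
    let B , |B|<f , l⊆B , 𝓕B = H (length l) (l , sorted) refl
    in B , ≤-trans (<⇒≤ |B|<f) (≤-partialSum f m l≤m) , λ _ _ → (λ {x} → l⊆B x) , 𝓕B
  ... | no unsorted | _       = ([] , []) , z≤n , λ sorted _ → contradiction sorted unsorted
  ... | yes _       | no l≰m  = ([] , []) , z≤n , λ _ l≤m → contradiction l≤m l≰m

  open FreeSet m (partialSum f m) (proj₁ ∘ proj₁ ∘ cover) (proj₁ ∘ proj₂ ∘ cover) public

  free⇒shattered : ∀ {A} (sorted : Linked _<_ A) → length A ≤ m → Free A → Shattered 𝓕 (A , sorted)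
  free⇒shattered {A} _ |A|≤m free (l , sortedl) l⊆A =
    proj₁ (cover l) , proj₂ covered , λ x → mk⇔ (λ x∈l → l⊆A x x∈l , proj₁ covered x∈l) (from x)
    where
    l≤m : length l ≤ m
    l≤m = ≤-trans (Unique-⊆⇒length≤ (Linked<⇒Unique sortedl) (λ {x} → l⊆A x)) |A|≤m
    covered : l ⊆ proj₁ (proj₁ (cover l)) × 𝓕 (proj₁ (cover l))
    covered = proj₂ (proj₂ (cover l)) sortedl l≤m
    from : ∀ x → x ∈ A × x ∈ₛ proj₁ (cover l) → x ∈ l
    from x (x∈A , x∈W) with x ∈? l
    ... | yes x∈l = x∈l
    ... | no  x∉l = contradiction x∈W (free x x∈A l (λ {y} → l⊆A y) x∉l l≤m)

corollary2p6 : (𝓕 : Family) (f : ℕ → ℕ) →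
    (∀ (n : ℕ) (A : FinSet) → ∣ A ∣ₛ ≡ n →
      ∃[ B ] (∣ B ∣ₛ < f n × A ⊆ₛ B × 𝓕 B)) →
    VCInfinite 𝓕
corollary2p6 𝓕 f H m =
  let A , |A|≡m , sorted , free = freeSet m
  in (A , sorted) , ≤-reflexive (sym |A|≡m) , free⇒shattered sorted (≤-reflexive |A|≡m) free
  where open Witnesses 𝓕 f H m
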